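{- Let $G$ be a graph of girth at least 6. Then $\Gamma_{pr}(G)=2\Gamma(G)$ if and only if $G$ is isomorphic to $mK_2$ for some $m\geq 1$.
   Context: All graphs are finite, simple and undirected. A set $D\subseteq V(G)$ is dominating if every vertex is in $D$ or adjacent to a vertex of $D$; it is minimal if no proper subset is dominating. $\Gamma(G)$ is the maximum cardinality of a minimal dominating set of $G$. A paired dominating set (PDS) is a dominating set $D$ such that the induced subgraph $G[D]$ has a perfect matching; a PDS is minimal if no proper subset is a PDS. $\Gamma_{pr}(G)$ is the maximum cardinality of a minimal PDS of $G$. The girth of a graph is the length of its shortest cycle (an acyclic graph is regarded as having girth at least 6). $mK_2$ denotes the disjoint union of $m$ copies of $K_2$. -}

module Defs where

open import Data.Nat using (ℕ; zero; suc; _*_; _≤_; _<_; _∸_)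
open import Data.Nat.DivMod using (_/_)
open import Data.Fin using (Fin; toℕ)
open import Data.Fin.Subset using (Subset; _∈_; _⊂_; ∣_∣)
open import Data.Product using (Σ; ∃; ∃-syntax; _×_; _,_)
open import Data.Sum using (_⊎_)
open import Relation.Nullary using (¬_)
open import Relation.Binary.PropositionalEquality using (_≡_; _≢_; refl; sym)
open import Function.Bundles using (_⤖_; _⇔_; Bijection)
open import Function.Definitions using (Injective)

record Graph (n : ℕ) : Set₁ where
  field
    Adj     : Fin n → Fin n → Set
    sym-adj : ∀ {u v} → Adj u v → Adj v u
    irrefl  : ∀ {u} → ¬ Adj u u
open Graph public

module _ {n : ℕ} (G : Graph n) where

  Dominating : Subset n → Set
  Dominating D = ∀ v → v ∈ D ⊎ (∃[ u ] (u ∈ D × Adj G u v))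

  MinimalDominating : Subset n → Set
  MinimalDominating D = Dominating D × (∀ D′ → D′ ⊂ D → ¬ Dominating D′)

  -- G[D] has a perfect matching, encoded by the partner map M:
  -- each v ∈ D is matched to M v ∈ D, with v M v an edge, and M v's partner is v.
  HasPerfectMatching : Subset n → Set
  HasPerfectMatching D =
    Σ (Fin n → Fin n) λ M →
      ∀ v → v ∈ D → (M v ∈ D) × Adj G v (M v) × (M (M v) ≡ v)

  PairedDominating : Subset n → Set
  PairedDominating D = Dominating D × HasPerfectMatching D

  MinimalPairedDominating : Subset n → Set
  MinimalPairedDominating D =
    PairedDominating D × (∀ D′ → D′ ⊂ D → ¬ PairedDominating D′)

  IsMaxCard : (Subset n → Set) → ℕ → Set
  IsMaxCard P k = (∃[ D ] (P D × ∣ D ∣ ≡ k)) × (∀ D → P D → ∣ D ∣ ≤ k)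

  IsUpperDomination : ℕ → Set
  IsUpperDomination = IsMaxCard MinimalDominating

  IsUpperPairedDomination : ℕ → Set
  IsUpperPairedDomination = IsMaxCard MinimalPairedDominating

  HasCycleOfLength : ℕ → Set
  HasCycleOfLength k =
    Σ (Fin k → Fin n) λ c →
      Injective _≡_ _≡_ c
      × (∀ i j → suc (toℕ i) ≡ toℕ j → Adj G (c i) (c j))
      × (∀ i j → suc (toℕ i) ≡ k → toℕ j ≡ 0 → Adj G (c i) (c j))

  GirthAtLeast6 : Set
  GirthAtLeast6 = ∀ k → 3 ≤ k → k < 6 → ¬ HasCycleOfLength k

-- m K₂ on vertex set Fin (2 * m): vertices 2i and 2i+1 form an edge.
mK₂ : (m : ℕ) → Graph (2 * m)
mK₂ m = record
  { Adj     = λ u v → (toℕ u / 2 ≡ toℕ v / 2) × (u ≢ v)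
  ; sym-adj = λ { (e , ne) → sym e , λ p → ne (sym p) }
  ; irrefl  = λ { (_ , ne) → ne refl }
  }

_≅_ : ∀ {n N} → Graph n → Graph N → Set
_≅_ {n} {N} G H =
  Σ (Fin n ⤖ Fin N) λ f →
    ∀ u v → Adj G u v ⇔ Adj H (Bijection.to f u) (Bijection.to f v)

-- If G ≅ mK₂, every paired dominating set is all of V(G) and every minimal dominating set
-- contains exactly one end of each edge, so Γpr = 2m = 2Γ.
--
-- Conversely, let D be a minimal paired dominating set with matching M and ∣ D ∣ = 2Γ.
-- A map on D whose fibres lie inside the pairs {w, M w} takes at least Γ values, so no
-- minimal dominating set contains such values together with one further vertex. By
-- minimality of D each pair dominates some vertex alone. If both ends of a pair have private
-- neighbours outside D, a minimal dominating subset of D contains both ends and meets every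
-- other pair. Otherwise we pick one vertex in the "territory" of each pair (an end of it, or
-- a private neighbour of an end); if a vertex lay outside D, the picks could be made so
-- that, together with one outside vertex, they form an independent set (girth ≥ 6 rules out
-- the triangles and pentagons that would spoil this), and an independent set extends to a
-- minimal dominating set. So D = V(G), and an edge outside the matching would allow a
-- re-pairing with a smaller paired dominating set. Hence G is the matching M, i.e. G ≅ mK₂.

module Submission where

open import Defs
open import Data.Nat as ℕ using (ℕ; zero; suc; _+_; _*_; _≤_; _<_; _≥_; z≤n; s≤s)
import Data.Nat.Properties as ℕP
open import Data.Nat.DivMod using (_/_; m/n≡1+[m∸n]/n; m*n/n≡m)
open import Data.Fin as F using (Fin; zero; suc; toℕ; fromℕ<; punchOut)
import Data.Fin.Properties as FP
open import Data.Fin.Subset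
  using (Subset; _∈_; _∉_; _⊆_; _⊂_; ∣_∣; inside; outside; ⊤; ∁; _∩_; _─_; _-_; ⁅_⁆)
open import Data.Fin.Subset.Properties
  using ( _∈?_; _⊂?_; anySubset?; ∈⊤; ∣⊤∣≡n; ∣p∣≤n; ∣∁p∣≡n∸∣p∣; x∉p⇒x∈∁p; x∈∁p⇒x∉p
        ; p⊆q⇒∣p∣≤∣q∣; p⊂q⇒∣p∣<∣q∣; ⊆-⊂-trans; x∈p∩q⁺; x∈p∩q⁻; p∩q⊆p; p─q⊆p
        ; x∈p∧x∉q⇒x∈p─q; x∈p∧x≢y⇒x∈p-y; x∈p⇒p-x⊂p; x∈p⇒∣p-x∣<∣p∣; x∈⁅x⁆)
open import Data.Fin.Subset.Induction using (⊂-wellFounded; Acc; acc)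
open import Data.Vec using (Vec; []; _∷_; tabulate; lookup; head; last; here; there)
import Data.Vec.Properties as VP
open import Data.Vec.Relation.Unary.All using ([]; _∷_)
open import Data.Vec.Relation.Unary.AllPairs using ([]; _∷_)
open import Data.Vec.Relation.Unary.Linked using (Linked; [-]; _∷_)
open import Data.Vec.Relation.Unary.Unique.Propositional using (Unique)
open import Data.Vec.Relation.Unary.Unique.Propositional.Properties using (lookup-injective)
open import Data.Product using (∃; ∃-syntax; _×_; _,_; proj₁; proj₂; uncurry)
open import Data.Sum as Sum using (_⊎_; inj₁; inj₂; [_,_])
open import Data.Empty using (⊥; ⊥-elim)
open import Relation.Nullary using (¬_; Dec; yes; no; does; contradiction; ¬¬-excluded-middle)
open import Relation.Nullary.Decidable using (_×-dec_; _⊎-dec_; ¬?; _→-dec_; map′)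
open import Relation.Unary using (Pred; Decidable)
open import Relation.Binary.Definitions using (tri<; tri≈; tri>)
open import Relation.Binary.PropositionalEquality
  using (_≡_; _≢_; refl; sym; trans; cong; cong₂; subst; module ≡-Reasoning)
open import Function using (_∘_; id)
open import Function.Bundles using (mk⤖; _⇔_; mk⇔; Bijection; Equivalence)
open import Function.Definitions using (Injective; Surjective)

select : ∀ {n ℓ} {P : Pred (Fin n) ℓ} → Decidable P → Subset n
select P? = tabulate (does ∘ P?)

module _ {n ℓ} {P : Pred (Fin n) ℓ} (P? : Decidable P) {x : Fin n} where

  ∈-select⁺ : P x → x ∈ select P?
  ∈-select⁺ px = VP.lookup⇒[]= x _ (trans (VP.lookup∘tabulate _ x) (yes-does (P? x)))
    where
    yes-does : (d : Dec (P x)) → does d ≡ inside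
    yes-does (yes _)  = refl
    yes-does (no ¬px) = contradiction px ¬px

  ∈-select⁻ : x ∈ select P? → P x
  ∈-select⁻ x∈ = does-yes (P? x) (trans (sym (VP.lookup∘tabulate _ x)) (VP.[]=⇒lookup x∈))
    where
    does-yes : (d : Dec (P x)) → does d ≡ inside → P x
    does-yes (yes px) _ = px

x∈p─q⇒x∉q : ∀ {n} {x : Fin n} (p q : Subset n) → x ∈ p ─ q → x ∉ q
x∈p─q⇒x∉q (inside ∷ p) (outside ∷ q) here        ()
x∈p─q⇒x∉q (_      ∷ p) (_       ∷ q) (there x∈) (there x∈q) = x∈p─q⇒x∉q p q x∈ x∈q

x∈p-y⁻ : ∀ {n} {x y : Fin n} {p : Subset n} → x ∈ p - y → x ∈ p × x ≢ y
x∈p-y⁻ {y = y} {p} x∈ = p─q⊆p p ⁅ y ⁆ x∈ , λ { refl → x∈p─q⇒x∉q p ⁅ y ⁆ x∈ (x∈⁅x⁆ y) }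

∣p∣≡∣p∩q∣+∣p─q∣ : ∀ {n} (p q : Subset n) → ∣ p ∣ ≡ ∣ p ∩ q ∣ + ∣ p ─ q ∣
∣p∣≡∣p∩q∣+∣p─q∣ []            []            = refl
∣p∣≡∣p∩q∣+∣p─q∣ (inside ∷ p)  (inside ∷ q)  = cong suc (∣p∣≡∣p∩q∣+∣p─q∣ p q)
∣p∣≡∣p∩q∣+∣p─q∣ (inside ∷ p)  (outside ∷ q) =
  trans (cong suc (∣p∣≡∣p∩q∣+∣p─q∣ p q)) (sym (ℕP.+-suc _ _))
∣p∣≡∣p∩q∣+∣p─q∣ (outside ∷ p) (inside ∷ q)  = ∣p∣≡∣p∩q∣+∣p─q∣ p q
∣p∣≡∣p∩q∣+∣p─q∣ (outside ∷ p) (outside ∷ q) = ∣p∣≡∣p∩q∣+∣p─q∣ p q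

injection⇒∣p∣≤∣q∣ : ∀ {n m} (p : Subset n) (q : Subset m) (f : Fin n → Fin m) →
  (∀ {x} → x ∈ p → f x ∈ q) → (∀ {x y} → x ∈ p → y ∈ p → f x ≡ f y → x ≡ y) →
  ∣ p ∣ ≤ ∣ q ∣
injection⇒∣p∣≤∣q∣ []            q f _    _   = z≤n
injection⇒∣p∣≤∣q∣ (outside ∷ p) q f into inj =
  injection⇒∣p∣≤∣q∣ p q (f ∘ suc) (into ∘ there)
    (λ x∈ y∈ → FP.suc-injective ∘ inj (there x∈) (there y∈))
injection⇒∣p∣≤∣q∣ (inside ∷ p)  q f into inj = ℕP.≤-trans
  (s≤s (injection⇒∣p∣≤∣q∣ p (q - f zero) (f ∘ suc)
    (λ x∈ → x∈p∧x≢y⇒x∈p-y (into (there x∈)) (λ e → 0≢suc (inj here (there x∈) (sym e))))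
    (λ x∈ y∈ → FP.suc-injective ∘ inj (there x∈) (there y∈))))
  (x∈p⇒∣p-x∣<∣p∣ (into here))
  where
  0≢suc : ∀ {k} {i : Fin k} → zero ≢ suc i
  0≢suc ()

module _ {n} (p : Subset n) where

  below? : (x : Fin n) → Decidable (λ y → y ∈ p × y F.< x)
  below? x y = (y ∈? p) ×-dec (y F.<? x)

  below : Fin n → Subset n
  below x = select (below? x)

  rank : Fin n → ℕ
  rank x = ∣ below x ∣

  private
    x∉below : ∀ {x} → x ∉ below x
    x∉below {x} x∈ = FP.<-irrefl refl (proj₂ (∈-select⁻ (below? x) x∈))

  rank<∣p∣ : ∀ {x} → x ∈ p → rank x < ∣ p ∣
  rank<∣p∣ {x} x∈p = p⊂q⇒∣p∣<∣q∣
    (proj₁ ∘ ∈-select⁻ (below? x) , x , x∈p , x∉below)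

  rank-mono : ∀ {x y} → x ∈ p → x F.< y → rank x < rank y
  rank-mono {x} {y} x∈p x<y = p⊂q⇒∣p∣<∣q∣
    ( (λ z∈ → let (z∈p , z<x) = ∈-select⁻ (below? x) z∈ in
               ∈-select⁺ (below? y) (z∈p , FP.<-trans z<x x<y))
    , x , ∈-select⁺ (below? y) (x∈p , x<y) , x∉below)

  rank-injective : ∀ {x y} → x ∈ p → y ∈ p → rank x ≡ rank y → x ≡ y
  rank-injective {x} {y} x∈p y∈p e with FP.<-cmp x y
  ... | tri< x<y _ _ = contradiction e (ℕP.<⇒≢ (rank-mono x∈p x<y))
  ... | tri≈ _ x≡y _ = x≡y
  ... | tri> _ _ y<x = contradiction (sym e) (ℕP.<⇒≢ (rank-mono y∈p y<x))

full⇒∣p∣≡n : ∀ {n} {p : Subset n} → (∀ x → x ∈ p) → ∣ p ∣ ≡ n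
full⇒∣p∣≡n {n} {p} full =
  ℕP.≤-antisym (∣p∣≤n p) (subst (_≤ ∣ p ∣) (∣⊤∣≡n n) (p⊆q⇒∣p∣≤∣q∣ {p = ⊤} (λ {x} _ → full x)))

injective⇒surjective : ∀ {n n′} → n ≡ n′ → {f : Fin n → Fin n′} →
  Injective _≡_ _≡_ f → Surjective _≡_ _≡_ f
injective⇒surjective {suc _} refl {f} f-inj y with FP.any? (λ x → f x FP.≟ y)
... | yes (x , fx≡y) = x , λ { refl → fx≡y }
... | no  missed     = contradiction (FP.injective⇒≤ punched-injective) (ℕP.<-irrefl refl)
  where
  punched-injective : Injective _≡_ _≡_ (λ x → punchOut {i = y} {j = f x} (λ e → missed (x , sym e)))
  punched-injective {x} {x′} e =
    f-inj (FP.punchOut-injective {i = y} (λ e′ → missed (x , sym e′)) (λ e′ → missed (x′ , sym e′)) e)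
injective⇒surjective {zero} refl _ ()

module Involution {n} (D : Subset n) (M : Fin n → Fin n)
  (M-closed      : ∀ {x} → x ∈ D → M x ∈ D)
  (M-involutive  : ∀ {x} → x ∈ D → M (M x) ≡ x)
  (M-fixpointFree : ∀ {x} → x ∈ D → M x ≢ x) where

  open import Algebra.Construct.NaturalChoice.Min (FP.≤-totalOrder n) using (_⊓_; ⊓-sel; ⊓-comm)

  infix 4 _≋_
  _≋_ : Fin n → Fin n → Set
  x ≋ y = y ≡ x ⊎ y ≡ M x

  ≋-refl : ∀ {x} → x ≋ x
  ≋-refl = inj₁ refl

  ≋-partner : ∀ {x} → x ≋ M x
  ≋-partner = inj₂ refl

  ≋-sym : ∀ {x y} → x ∈ D → x ≋ y → y ≋ x
  ≋-sym x∈ (inj₁ refl) = ≋-refl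
  ≋-sym x∈ (inj₂ refl) = inj₂ (sym (M-involutive x∈))

  ≋-trans : ∀ {x y z} → x ∈ D → x ≋ y → y ≋ z → x ≋ z
  ≋-trans x∈ (inj₁ refl) y≋z         = y≋z
  ≋-trans x∈ (inj₂ refl) (inj₁ refl) = ≋-partner
  ≋-trans x∈ (inj₂ refl) (inj₂ refl) = inj₁ (M-involutive x∈)

  ≋-closed : ∀ {x y} → x ∈ D → x ≋ y → y ∈ D
  ≋-closed x∈ (inj₁ refl) = x∈
  ≋-closed x∈ (inj₂ refl) = M-closed x∈

  M-injective : ∀ {x y} → x ∈ D → y ∈ D → M x ≡ M y → x ≡ y
  M-injective x∈ y∈ e = trans (sym (M-involutive x∈)) (trans (cong M e) (M-involutive y∈))

  rep : Fin n → Fin n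
  rep x = x ⊓ M x

  ≋-rep : ∀ x → x ≋ rep x
  ≋-rep x = ⊓-sel x (M x)

  rep-partner : ∀ {x} → x ∈ D → rep (M x) ≡ rep x
  rep-partner {x} x∈ = trans (cong (M x ⊓_) (M-involutive x∈)) (⊓-comm (M x) x)

  rep-cong : ∀ {x y} → x ∈ D → x ≋ y → rep y ≡ rep x
  rep-cong x∈ (inj₁ refl) = refl
  rep-cong x∈ (inj₂ refl) = rep-partner x∈

  rep≡⇒≋ : ∀ {x y} → x ∈ D → y ∈ D → rep x ≡ rep y → x ≋ y
  rep≡⇒≋ {x} {y} x∈ y∈ e = ≋-trans x∈ (subst (x ≋_) e (≋-rep x)) (≋-sym y∈ (≋-rep y))

  isRep? : Decidable (λ x → rep x ≡ x)
  isRep? x = rep x FP.≟ x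

  Reps : Subset n
  Reps = select isRep?

  rep∈D : ∀ {x} → x ∈ D → rep x ∈ D
  rep∈D {x} x∈ = ≋-closed x∈ (≋-rep x)

  rep-idempotent : ∀ {x} → x ∈ D → rep (rep x) ≡ rep x
  rep-idempotent {x} x∈ = rep-cong x∈ (≋-rep x)

  rep∈Reps : ∀ {x} → x ∈ D → rep x ∈ Reps
  rep∈Reps x∈ = ∈-select⁺ isRep? (rep-idempotent x∈)

  ∉Reps⇒rep≡M : ∀ {x} → x ∉ Reps → rep x ≡ M x
  ∉Reps⇒rep≡M {x} x∉ with ≋-rep x
  ... | inj₁ e = contradiction (∈-select⁺ isRep? e) x∉
  ... | inj₂ e = e

  M-swaps-Reps : ∀ {x} → x ∈ D → x ∈ Reps → M x ∉ Reps
  M-swaps-Reps {x} x∈ x∈R Mx∈R = M-fixpointFree x∈ (begin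
    M x         ≡⟨ ∈-select⁻ isRep? Mx∈R ⟨
    rep (M x)   ≡⟨ rep-partner x∈ ⟩
    rep x       ≡⟨ ∈-select⁻ isRep? x∈R ⟩
    x           ∎)
    where open ≡-Reasoning

  M-swaps-∁Reps : ∀ {x} → x ∈ D → x ∉ Reps → M x ∈ Reps
  M-swaps-∁Reps {x} x∈ x∉R = ∈-select⁺ isRep? (trans (rep-partner x∈) (∉Reps⇒rep≡M x∉R))

  private
    ∩-inD : ∀ {x} → x ∈ D ∩ Reps → x ∈ D
    ∩-inD = p∩q⊆p D Reps

    ─-inD : ∀ {x} → x ∈ D ─ Reps → x ∈ D
    ─-inD = p─q⊆p D Reps

  ∣D∣≡2∣D∩Reps∣ : ∣ D ∣ ≡ ∣ D ∩ Reps ∣ + ∣ D ∩ Reps ∣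
  ∣D∣≡2∣D∩Reps∣ = trans (∣p∣≡∣p∩q∣+∣p─q∣ D Reps) (cong (∣ D ∩ Reps ∣ +_) (ℕP.≤-antisym
    (injection⇒∣p∣≤∣q∣ (D ─ Reps) (D ∩ Reps) M into-∩
      (λ x∈ y∈ → M-injective (─-inD x∈) (─-inD y∈)))
    (injection⇒∣p∣≤∣q∣ (D ∩ Reps) (D ─ Reps) M into-─
      (λ x∈ y∈ → M-injective (∩-inD x∈) (∩-inD y∈)))))
    where
    into-∩ : ∀ {x} → x ∈ D ─ Reps → M x ∈ D ∩ Reps
    into-∩ x∈ = x∈p∩q⁺ (M-closed (─-inD x∈) , M-swaps-∁Reps (─-inD x∈) (x∈p─q⇒x∉q D Reps x∈))
    into-─ : ∀ {x} → x ∈ D ∩ Reps → M x ∈ D ─ Reps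
    into-─ x∈ = x∈p∧x∉q⇒x∈p─q (M-closed (∩-inD x∈))
                               (M-swaps-Reps (∩-inD x∈) (proj₂ (x∈p∩q⁻ D Reps x∈)))

  pair-bound : (B : Subset n) (φ : Fin n → Fin n) → (∀ {x} → x ∈ D → φ x ∈ B) →
    (∀ {x y} → x ∈ D → y ∈ D → φ x ≡ φ y → x ≋ y) → ∣ D ∣ ≤ ∣ B ∣ + ∣ B ∣
  pair-bound B φ into fibres = subst (_≤ ∣ B ∣ + ∣ B ∣) (sym ∣D∣≡2∣D∩Reps∣) (ℕP.+-mono-≤ bound bound)
    where
    isRep : ∀ {x} → x ∈ D ∩ Reps → rep x ≡ x
    isRep = ∈-select⁻ isRep? ∘ proj₂ ∘ x∈p∩q⁻ D Reps
    inj : ∀ {x y} → x ∈ D ∩ Reps → y ∈ D ∩ Reps → φ x ≡ φ y → x ≡ y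
    inj x∈ y∈ e = trans (sym (isRep x∈))
      (trans (sym (rep-cong (∩-inD x∈) (fibres (∩-inD x∈) (∩-inD y∈) e))) (isRep y∈))
    bound : ∣ D ∩ Reps ∣ ≤ ∣ B ∣
    bound = injection⇒∣p∣≤∣q∣ (D ∩ Reps) B φ (into ∘ ∩-inD) inj

linked-lookup : ∀ {a r} {A : Set a} {R : A → A → Set r} {k} {xs : Vec A k} → Linked R xs →
  ∀ i j → suc (toℕ i) ≡ toℕ j → R (lookup xs i) (lookup xs j)
linked-lookup [-]                   zero    zero          ()
linked-lookup {xs = _ ∷ _ ∷ _} (r ∷ _)  zero    (suc zero)    refl = r
linked-lookup {xs = _ ∷ _ ∷ _} (_ ∷ rs) (suc i) (suc j)       e    = linked-lookup rs i j (ℕP.suc-injective e)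

lookup-fromℕ : ∀ {a} {A : Set a} {k} (xs : Vec A (suc k)) → lookup xs (F.fromℕ k) ≡ last xs
lookup-fromℕ (x ∷ [])     = refl
lookup-fromℕ (x ∷ y ∷ xs) = lookup-fromℕ (y ∷ xs)

module _ {n} (G : Graph n) where

  adj⇒≢ : ∀ {u v} → Adj G u v → u ≢ v
  adj⇒≢ a refl = irrefl G a

  closed-walk⇒cycle : ∀ {k} (cs : Vec (Fin n) (suc k)) → Unique cs → Linked (Adj G) cs →
    Adj G (last cs) (head cs) → HasCycleOfLength G (suc k)
  closed-walk⇒cycle {k} cs@(_ ∷ _) unique linked closing =
    lookup cs , (λ {i} {j} → lookup-injective unique i j) , linked-lookup linked , wrap
    where
    wrap : ∀ i j → suc (toℕ i) ≡ suc k → toℕ j ≡ 0 → Adj G (lookup cs i) (lookup cs j)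
    wrap i j i≡k j≡0
      rewrite FP.toℕ-injective {i = i} (trans (ℕP.suc-injective i≡k) (sym (FP.toℕ-fromℕ k)))
            | FP.toℕ-injective {i = j} {j = zero} j≡0
            | lookup-fromℕ cs = closing

  module _ (girth : GirthAtLeast6 G) where

    triangle-free : ∀ {a b c} → Adj G a b → Adj G b c → ¬ Adj G c a
    triangle-free ab bc ca = girth 3 (s≤s (s≤s (s≤s z≤n))) (s≤s (s≤s (s≤s (s≤s z≤n))))
      (closed-walk⇒cycle (_ ∷ _ ∷ _ ∷ [])
        ((adj⇒≢ ab ∷ (λ e → adj⇒≢ ca (sym e)) ∷ []) ∷ (adj⇒≢ bc ∷ []) ∷ [] ∷ [])
        (ab ∷ bc ∷ [-]) ca)

    -- A closed 5-walk that repeats a vertex contains a triangle.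
    pentagon-free : ∀ {a b c d e} → Adj G a b → Adj G b c → Adj G c d → Adj G d e → ¬ Adj G e a
    pentagon-free {a} {b} {c} {d} {e} ab bc cd de ea
      with a FP.≟ c | a FP.≟ d | b FP.≟ d | b FP.≟ e | c FP.≟ e
    ... | yes refl | _        | _        | _        | _        = triangle-free cd de ea
    ... | no _     | yes refl | _        | _        | _        = triangle-free ab bc cd
    ... | no _     | no _     | yes refl | _        | _        = triangle-free ab de ea
    ... | no _     | no _     | no _     | yes refl | _        = triangle-free bc cd de
    ... | no _     | no _     | no _     | no _     | yes refl = triangle-free ab bc ea
    ... | no a≢c   | no a≢d   | no b≢d   | no b≢e   | no c≢e   =
      girth 5 (s≤s (s≤s (s≤s z≤n))) (s≤s (s≤s (s≤s (s≤s (s≤s (s≤s z≤n))))))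
        (closed-walk⇒cycle (a ∷ b ∷ c ∷ d ∷ e ∷ [])
          ((adj⇒≢ ab ∷ a≢c ∷ a≢d ∷ (λ x → adj⇒≢ ea (sym x)) ∷ [])
            ∷ (adj⇒≢ bc ∷ b≢d ∷ b≢e ∷ []) ∷ (adj⇒≢ cd ∷ c≢e ∷ []) ∷ (adj⇒≢ de ∷ []) ∷ [] ∷ [])
          (ab ∷ bc ∷ cd ∷ de ∷ [-]) ea)

¬¬-∀Fin : ∀ {n p} {P : Fin n → Set p} → (∀ i → ¬ ¬ P i) → ¬ ¬ (∀ i → P i)
¬¬-∀Fin {zero}  _ k = k λ ()
¬¬-∀Fin {suc n} h k = h zero λ p₀ → ¬¬-∀Fin (h ∘ suc) λ ps → k λ { zero → p₀ ; (suc i) → ps i }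

¬¬-adj? : ∀ {n} (G : Graph n) → ¬ ¬ (∀ u v → Dec (Adj G u v))
¬¬-adj? G = ¬¬-∀Fin λ u → ¬¬-∀Fin λ v → ¬¬-excluded-middle

module Domination {n} (G : Graph n) (adj? : ∀ u v → Dec (Adj G u v)) where

  dominating? : Decidable (Dominating G)
  dominating? D = FP.all? λ v → (v ∈? D) ⊎-dec FP.any? λ u → (u ∈? D) ×-dec adj? u v

  minimal-dominating-⊆ : ∀ {D} → Dominating G D → ∃[ S ] (S ⊆ D × MinimalDominating G S)
  minimal-dominating-⊆ {D} = go D (⊂-wellFounded D)
    where
    go : ∀ D → Acc _⊂_ D → Dominating G D → ∃[ S ] (S ⊆ D × MinimalDominating G S)
    go D (acc smaller) dom with anySubset? (λ S → (S ⊂? D) ×-dec dominating? S)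
    ... | no none = D , id , dom , λ S S⊂D domS → none (S , S⊂D , domS)
    ... | yes (S , S⊂D@(S⊆D , _) , domS) with go S (smaller S⊂D) domS
    ...   | T , T⊆S , minT = T , S⊆D ∘ T⊆S , minT

  Independent : Subset n → Set
  Independent I = ∀ {a b} → a ∈ I → b ∈ I → ¬ Adj G a b

  module _ {I : Subset n} (indep : Independent I) where

    private
      hasNeighbourIn? : Decidable λ a → ∃[ b ] (b ∈ I × Adj G b a)
      hasNeighbourIn? a = FP.any? λ b → (b ∈? I) ×-dec adj? b a

      Y : Subset n
      Y = select (¬? ∘ hasNeighbourIn?)

      Y-dominating : Dominating G Y
      Y-dominating a with hasNeighbourIn? a
      ... | no  none           = inj₁ (∈-select⁺ (¬? ∘ hasNeighbourIn?) none)
      ... | yes (b , b∈I , ba) =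
        inj₂ (b , ∈-select⁺ (¬? ∘ hasNeighbourIn?) (λ (c , c∈I , cb) → indep c∈I b∈I cb) , ba)

    independent⊆minimal-dominating : ∃[ S ] (I ⊆ S × MinimalDominating G S)
    independent⊆minimal-dominating with minimal-dominating-⊆ Y-dominating
    ... | S , S⊆Y , minS@(domS , _) = S , I⊆S , minS
      where
      I⊆S : I ⊆ S
      I⊆S {a} a∈I with domS a
      ... | inj₁ a∈S            = a∈S
      ... | inj₂ (s , s∈S , sa) =
        contradiction (a , a∈I , sym-adj G sa) (∈-select⁻ (¬? ∘ hasNeighbourIn?) (S⊆Y s∈S))

flip : ℕ → ℕ
flip zero          = 1
flip (suc zero)    = 0
flip (suc (suc k)) = suc (suc (flip k))

2+k/2≡1+k/2 : ∀ k → suc (suc k) / 2 ≡ suc (k / 2)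
2+k/2≡1+k/2 k = m/n≡1+[m∸n]/n {suc (suc k)} {2} (s≤s (s≤s z≤n))

flip/2 : ∀ k → flip k / 2 ≡ k / 2
flip/2 zero          = refl
flip/2 (suc zero)    = refl
flip/2 (suc (suc k)) = trans (2+k/2≡1+k/2 (flip k)) (trans (cong suc (flip/2 k)) (sym (2+k/2≡1+k/2 k)))

flip≢ : ∀ k → flip k ≢ k
flip≢ (suc (suc k)) e = flip≢ k (ℕP.suc-injective (ℕP.suc-injective e))

flip< : ∀ {k} m → k < 2 * m → flip k < 2 * m
flip< {k} (suc m) k< rewrite ℕP.*-suc 2 m with k | k<
... | zero          | _                 = s≤s (s≤s z≤n)
... | suc zero      | _                 = s≤s z≤n
... | suc (suc k′)  | s≤s (s≤s k′<)     = s≤s (s≤s (flip< m k′<))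

/2-fibre : ∀ x y → x / 2 ≡ y / 2 → y ≡ x ⊎ y ≡ flip x
/2-fibre zero                zero          _ = inj₁ refl
/2-fibre zero                (suc zero)    _ = inj₂ refl
/2-fibre (suc zero)          zero          _ = inj₂ refl
/2-fibre (suc zero)          (suc zero)    _ = inj₁ refl
/2-fibre zero                (suc (suc y)) e = contradiction (trans e (2+k/2≡1+k/2 y)) λ ()
/2-fibre (suc zero)          (suc (suc y)) e = contradiction (trans e (2+k/2≡1+k/2 y)) λ ()
/2-fibre (suc (suc x))       zero          e = contradiction (trans (sym e) (2+k/2≡1+k/2 x)) λ ()
/2-fibre (suc (suc x))       (suc zero)    e = contradiction (trans (sym e) (2+k/2≡1+k/2 x)) λ ()
/2-fibre (suc (suc x))       (suc (suc y)) e = Sum.map (cong (2 +_)) (cong (2 +_))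
  (/2-fibre x y (ℕP.suc-injective (trans (sym (2+k/2≡1+k/2 x)) (trans e (2+k/2≡1+k/2 y)))))

record 1-Regular {n} (G : Graph n) : Set where
  field
    partner     : Fin n → Fin n
    adj-partner : ∀ u → Adj G u (partner u)
    adj⇒partner : ∀ {u v} → Adj G u v → v ≡ partner u

  partner-involutive : ∀ u → partner (partner u) ≡ u
  partner-involutive u = sym (adj⇒partner (sym-adj G (adj-partner u)))

  partner-injective : ∀ {u v} → partner u ≡ partner v → u ≡ v
  partner-injective {u} {v} e =
    trans (sym (partner-involutive u)) (trans (cong partner e) (partner-involutive v))

  partner≢ : ∀ u → partner u ≢ u
  partner≢ u e = irrefl G (subst (Adj G u) e (adj-partner u))

mK₂-1-regular : ∀ m → 1-Regular (mK₂ m)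
mK₂-1-regular m = record { partner = partner ; adj-partner = adj-partner ; adj⇒partner = adj⇒partner }
  where
  partner : Fin (2 * m) → Fin (2 * m)
  partner u = fromℕ< (flip< m (FP.toℕ<n u))
  toℕ-partner : ∀ u → toℕ (partner u) ≡ flip (toℕ u)
  toℕ-partner u = FP.toℕ-fromℕ< _
  adj-partner : ∀ u → Adj (mK₂ m) u (partner u)
  adj-partner u = sym (trans (cong (_/ 2) (toℕ-partner u)) (flip/2 (toℕ u)))
                , λ e → flip≢ (toℕ u) (trans (sym (toℕ-partner u)) (cong toℕ (sym e)))
  adj⇒partner : ∀ {u v} → Adj (mK₂ m) u v → v ≡ partner u
  adj⇒partner {u} {v} (e , u≢v) with /2-fibre (toℕ u) (toℕ v) e
  ... | inj₁ v≡u     = contradiction (sym (FP.toℕ-injective v≡u)) u≢v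
  ... | inj₂ v≡flipu = FP.toℕ-injective (trans v≡flipu (sym (toℕ-partner u)))

1-regular-≅ : ∀ {n N} {G : Graph n} {H : Graph N} → G ≅ H → 1-Regular H → 1-Regular G
1-regular-≅ {n} {N} {G} {H} (f , adj⇔) reg = record
  { partner = partner ; adj-partner = adj-partner ; adj⇒partner = adj⇒partner }
  where
  open 1-Regular reg
    renaming (partner to partnerᴴ; adj-partner to adj-partnerᴴ; adj⇒partner to adj⇒partnerᴴ)
  to : Fin n → Fin N
  to = Bijection.to f
  from : Fin N → Fin n
  from y = proj₁ (Bijection.surjective f y)
  to-from : ∀ y → to (from y) ≡ y
  to-from y = proj₂ (Bijection.surjective f y) refl
  partner : Fin n → Fin n
  partner u = from (partnerᴴ (to u))
  adj-partner : ∀ u → Adj G u (partner u)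
  adj-partner u = Equivalence.from (adj⇔ u (partner u))
    (subst (Adj H (to u)) (sym (to-from _)) (adj-partnerᴴ (to u)))
  adj⇒partner : ∀ {u v} → Adj G u v → v ≡ partner u
  adj⇒partner {u} {v} a = Bijection.injective f
    (trans (adj⇒partnerᴴ (Equivalence.to (adj⇔ u v) a)) (sym (to-from _)))

module 1-RegularGraph {n} {G : Graph n} (reg : 1-Regular G) where
  open 1-Regular reg

  paired-dominating⇒full : ∀ {D} → PairedDominating G D → ∀ v → v ∈ D
  paired-dominating⇒full {D} (dom , N , matched) v with dom v
  ... | inj₁ v∈D            = v∈D
  ... | inj₂ (s , s∈D , sv) = let (Ns∈D , sNs , _) = matched s s∈D in
    subst (_∈ D) (trans (adj⇒partner sNs) (sym (adj⇒partner sv))) Ns∈D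

  -- A minimal dominating set contains exactly one vertex of each edge.
  minimal-dominating⇒half : ∀ {D} → MinimalDominating G D → ∣ D ∣ + ∣ D ∣ ≡ n
  minimal-dominating⇒half {D} (dom , minimal) = begin
    ∣ D ∣ + ∣ D ∣    ≡⟨ cong (∣ D ∣ +_) ∣D∣≡∣∁D∣ ⟩
    ∣ D ∣ + ∣ ∁ D ∣  ≡⟨ cong (∣ D ∣ +_) (∣∁p∣≡n∸∣p∣ D) ⟩
    ∣ D ∣ + (n ℕ.∸ ∣ D ∣) ≡⟨ ℕP.m+[n∸m]≡n (∣p∣≤n D) ⟩
    n                ∎
    where
    open ≡-Reasoning
    in⇒partner-out : ∀ {u} → u ∈ D → partner u ∉ D
    in⇒partner-out {u} u∈D pu∈D = minimal (D - u) (x∈p⇒p-x⊂p u∈D) dominating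
      where
      dominating : Dominating G (D - u)
      dominating z with z FP.≟ u | z ∈? D
      ... | yes refl | _     =
        inj₂ (partner u , x∈p∧x≢y⇒x∈p-y pu∈D (partner≢ u) , sym-adj G (adj-partner u))
      ... | no z≢u | yes z∈D = inj₁ (x∈p∧x≢y⇒x∈p-y z∈D z≢u)
      ... | no z≢u | no z∉D  with dom z
      ...   | inj₁ z∈D            = contradiction z∈D z∉D
      ...   | inj₂ (s , s∈D , sz) = inj₂ (s , x∈p∧x≢y⇒x∈p-y s∈D s≢u , sz)
        where
        s≢u : s ≢ u
        s≢u refl = z∉D (subst (_∈ D) (sym (adj⇒partner sz)) pu∈D)
    out⇒partner-in : ∀ {u} → u ∉ D → partner u ∈ D
    out⇒partner-in {u} u∉D with dom u
    ... | inj₁ u∈D            = contradiction u∈D u∉D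
    ... | inj₂ (s , s∈D , su) =
      subst (_∈ D) (trans (sym (partner-involutive s)) (cong partner (sym (adj⇒partner su)))) s∈D
    ∣D∣≡∣∁D∣ : ∣ D ∣ ≡ ∣ ∁ D ∣
    ∣D∣≡∣∁D∣ = ℕP.≤-antisym
      (injection⇒∣p∣≤∣q∣ D (∁ D) partner (x∉p⇒x∈∁p ∘ in⇒partner-out) (λ _ _ → partner-injective))
      (injection⇒∣p∣≤∣q∣ (∁ D) D partner (out⇒partner-in ∘ x∈∁p⇒x∉p) (λ _ _ → partner-injective))

  open Involution ⊤ partner (λ _ → ∈⊤) (λ {x} _ → partner-involutive x) (λ {x} _ → partner≢ x)

  -- Number the edges by the ranks of their representatives; the ends of edge i become 2i and 2i + 1.
  m : ℕ
  m = ∣ ⊤ ∩ Reps ∣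

  n≡2m : n ≡ 2 * m
  n≡2m = trans (sym (∣⊤∣≡n n)) (trans ∣D∣≡2∣D∩Reps∣ (cong (m +_) (sym (ℕP.+-identityʳ m))))

  private
    rep∈ : ∀ u → rep u ∈ ⊤ ∩ Reps
    rep∈ u = x∈p∩q⁺ (∈⊤ , rep∈Reps {u} ∈⊤)

  index : Fin n → ℕ
  index u = rank (⊤ ∩ Reps) (rep u)

  index-partner : ∀ u → index (partner u) ≡ index u
  index-partner u = cong (rank (⊤ ∩ Reps)) (rep-partner {u} ∈⊤)

  index≡⇒≋ : ∀ {u v} → index u ≡ index v → u ≋ v
  index≡⇒≋ {u} {v} e = rep≡⇒≋ ∈⊤ ∈⊤ (rank-injective (⊤ ∩ Reps) (rep∈ u) (rep∈ v) e)

  side : ∀ {P : Set} → Dec P → ℕ → ℕ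
  side (yes _) k = k
  side (no _)  k = flip k

  code : Fin n → ℕ
  code u = side (isRep? u) (2 * index u)

  code/2 : ∀ u → code u / 2 ≡ index u
  code/2 u = trans (side/2 (isRep? u)) (trans (cong (_/ 2) (ℕP.*-comm 2 (index u))) (m*n/n≡m (index u) 2))
    where
    side/2 : ∀ {P : Set} (d : Dec P) → side d (2 * index u) / 2 ≡ 2 * index u / 2
    side/2 (yes _) = refl
    side/2 (no _)  = flip/2 (2 * index u)

  code< : ∀ u → code u < 2 * m
  code< u = side< (isRep? u) (ℕP.*-monoʳ-< 2 (rank<∣p∣ (⊤ ∩ Reps) (rep∈ u)))
    where
    side< : ∀ {P : Set} (d : Dec P) {k} → k < 2 * m → side d k < 2 * m
    side< (yes _) k< = k<
    side< (no _)  k< = flip< m k<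

  -- Exactly one end of each edge is its representative.
  code-partner : ∀ u → code (partner u) ≢ code u
  code-partner u rewrite index-partner u with isRep? u | isRep? (partner u)
  ... | yes u-rep | yes pu-rep =
    contradiction (∈-select⁺ isRep? pu-rep) (M-swaps-Reps ∈⊤ (∈-select⁺ isRep? u-rep))
  ... | yes _     | no _       = flip≢ (2 * index u)
  ... | no _      | yes _      = flip≢ (2 * index u) ∘ sym
  ... | no u-rep  | no pu-rep  =
    contradiction (M-swaps-∁Reps ∈⊤ (u-rep ∘ ∈-select⁻ isRep?)) (pu-rep ∘ ∈-select⁻ isRep?)

  encode : Fin n → Fin (2 * m)
  encode u = fromℕ< (code< u)

  toℕ-encode : ∀ u → toℕ (encode u) ≡ code u
  toℕ-encode u = FP.toℕ-fromℕ< (code< u)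

  encode/2 : ∀ u → toℕ (encode u) / 2 ≡ index u
  encode/2 u = trans (cong (_/ 2) (toℕ-encode u)) (code/2 u)

  encode-injective : Injective _≡_ _≡_ encode
  encode-injective {u} {v} e
    with index≡⇒≋ (trans (sym (encode/2 u)) (trans (cong (λ w → toℕ w / 2) e) (encode/2 v)))
  ... | inj₁ v≡u  = sym v≡u
  ... | inj₂ refl =
    contradiction (trans (sym (toℕ-encode v)) (trans (cong toℕ (sym e)) (toℕ-encode u))) (code-partner u)

  encode-adj : ∀ u v → Adj G u v ⇔ Adj (mK₂ m) (encode u) (encode v)
  encode-adj u v = mk⇔ to from
    where
    to : Adj G u v → Adj (mK₂ m) (encode u) (encode v)
    to a rewrite adj⇒partner a =
      trans (encode/2 u) (sym (trans (encode/2 (partner u)) (index-partner u))) ,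
      λ e → partner≢ u (sym (encode-injective e))
    from : Adj (mK₂ m) (encode u) (encode v) → Adj G u v
    from (e , ne) with index≡⇒≋ {u} {v} (trans (sym (encode/2 u)) (trans e (encode/2 v)))
    ... | inj₁ refl = contradiction refl ne
    ... | inj₂ refl = adj-partner u

  ≅mK₂ : G ≅ mK₂ m
  ≅mK₂ = mk⤖ (encode-injective , injective⇒surjective n≡2m encode-injective) , encode-adj

module ExtremalPDS {n} (G : Graph n) (girth : GirthAtLeast6 G)
  {D : Subset n} (pds : PairedDominating G D)
  (minimal : ∀ D′ → D′ ⊂ D → ¬ PairedDominating G D′)
  {γ : ℕ} (Γ-bound : ∀ S → MinimalDominating G S → ∣ S ∣ ≤ γ) (∣D∣≡2γ : ∣ D ∣ ≡ 2 * γ) where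

  private
    dom : Dominating G D
    dom = proj₁ pds

  M : Fin n → Fin n
  M = proj₁ (proj₂ pds)

  M∈D : ∀ {u} → u ∈ D → M u ∈ D
  M∈D {u} u∈D = proj₁ (proj₂ (proj₂ pds) u u∈D)

  adj-M : ∀ {u} → u ∈ D → Adj G u (M u)
  adj-M {u} u∈D = proj₁ (proj₂ (proj₂ (proj₂ pds) u u∈D))

  M-involutive : ∀ {u} → u ∈ D → M (M u) ≡ u
  M-involutive {u} u∈D = proj₂ (proj₂ (proj₂ (proj₂ pds) u u∈D))

  M≢ : ∀ {u} → u ∈ D → M u ≢ u
  M≢ u∈D = adj⇒≢ G (adj-M u∈D) ∘ sym

  open Involution D M M∈D M-involutive M≢

  M-swap : ∀ {u v} → v ∈ D → u ≡ M v → v ≡ M u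
  M-swap v∈D u≡Mv = trans (sym (M-involutive v∈D)) (cong M (sym u≡Mv))

  ≋-chain : ∀ {v v′ a b} → v ∈ D → v′ ∈ D → v ≋ a → a ≋ b → v′ ≋ b → v ≋ v′
  ≋-chain v∈D v′∈D v≋a a≋b v′≋b = ≋-trans v∈D (≋-trans v∈D v≋a a≋b) (≋-sym v′∈D v′≋b)

  ∈-removed⁺ : ∀ {u a b} → u ∈ D → u ≢ a → u ≢ b → u ∈ D - a - b
  ∈-removed⁺ u∈D u≢a u≢b = x∈p∧x≢y⇒x∈p-y (x∈p∧x≢y⇒x∈p-y u∈D u≢a) u≢b

  ∈-removed⁻ : ∀ {u a b} → u ∈ D - a - b → u ∈ D × u ≢ a × u ≢ b
  ∈-removed⁻ u∈ = let (u∈D-a , u≢b) = x∈p-y⁻ u∈ ; (u∈D , u≢a) = x∈p-y⁻ u∈D-a in u∈D , u≢a , u≢b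

  ∉-removed : ∀ {u a b} → u ∈ D → u ∉ D - a - b → u ≡ a ⊎ u ≡ b
  ∉-removed {u} {a} {b} u∈D u∉ with u FP.≟ a | u FP.≟ b
  ... | yes u≡a | _       = inj₁ u≡a
  ... | no _    | yes u≡b = inj₂ u≡b
  ... | no u≢a  | no u≢b  = contradiction (∈-removed⁺ u∈D u≢a u≢b) u∉

  removed⊂D : ∀ {a b} → a ∈ D → D - a - b ⊂ D
  removed⊂D {a} {b} a∈D = ⊆-⊂-trans (p─q⊆p (D - a) ⁅ b ⁆) (x∈p⇒p-x⊂p a∈D)

  pair-removed-not-dominating : ∀ {v} → v ∈ D → ¬ Dominating G (D - v - M v)
  pair-removed-not-dominating {v} v∈D dom′ = minimal _ (removed⊂D v∈D) (dom′ , M , matched)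
    where
    matched : ∀ u → u ∈ D - v - M v → M u ∈ D - v - M v × Adj G u (M u) × M (M u) ≡ u
    matched u u∈ = let (u∈D , u≢v , u≢Mv) = ∈-removed⁻ u∈ in
      ∈-removed⁺ (M∈D u∈D) (u≢Mv ∘ M-swap u∈D ∘ sym)
                           (u≢v ∘ M-injective u∈D v∈D) ,
      adj-M u∈D , M-involutive u∈D

  -- Re-pair v with its neighbour w and keep all other pairs.
  rematching : ∀ {v w} → v ∈ D → w ∈ D → Adj G v w → w ≢ M v → HasPerfectMatching G (D - M v - M w)
  rematching {v} {w} v∈D w∈D vw w≢Mv = M′ , matched′
    where
    D′ : Subset n
    D′ = D - M v - M w
    M′ : Fin n → Fin n
    M′ u with u FP.≟ v | u FP.≟ w
    ... | yes _ | _     = w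
    ... | no _  | yes _ = v
    ... | no _  | no _  = M u
    M′v : M′ v ≡ w
    M′v with v FP.≟ v
    ... | yes _   = refl
    ... | no v≢v  = contradiction refl v≢v
    M′w : M′ w ≡ v
    M′w with w FP.≟ v | w FP.≟ w
    ... | yes w≡v | _       = contradiction (sym w≡v) (adj⇒≢ G vw)
    ... | no _    | yes _   = refl
    ... | no _    | no w≢w  = contradiction refl w≢w
    M′-other : ∀ {u} → u ≢ v → u ≢ w → M′ u ≡ M u
    M′-other {u} u≢v u≢w with u FP.≟ v | u FP.≟ w
    ... | yes u≡v | _       = contradiction u≡v u≢v
    ... | no _    | yes u≡w = contradiction u≡w u≢w
    ... | no _    | no _    = refl
    v≢Mw : v ≢ M w
    v≢Mw = w≢Mv ∘ M-swap w∈D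
    v∈D′ : v ∈ D′
    v∈D′ = ∈-removed⁺ v∈D (M≢ v∈D ∘ sym) v≢Mw
    w∈D′ : w ∈ D′
    w∈D′ = ∈-removed⁺ w∈D w≢Mv (M≢ w∈D ∘ sym)
    matched′ : ∀ u → u ∈ D′ → M′ u ∈ D′ × Adj G u (M′ u) × M′ (M′ u) ≡ u
    matched′ u u∈D′ with u FP.≟ v | u FP.≟ w
    ... | yes refl | _        = w∈D′ , vw , M′w
    ... | no _     | yes refl = v∈D′ , sym-adj G vw , M′v
    ... | no u≢v   | no u≢w   = let (u∈D , u≢Mv , u≢Mw) = ∈-removed⁻ u∈D′ in
      ∈-removed⁺ (M∈D u∈D) (u≢v ∘ M-injective u∈D v∈D) (u≢w ∘ M-injective u∈D w∈D) , adj-M u∈D ,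
      trans (M′-other (u≢Mv ∘ M-swap u∈D ∘ sym) (u≢Mw ∘ M-swap u∈D ∘ sym)) (M-involutive u∈D)

  rematched-not-dominating : ∀ {v w} → v ∈ D → w ∈ D → Adj G v w → w ≢ M v →
    ¬ Dominating G (D - M v - M w)
  rematched-not-dominating v∈D w∈D vw w≢Mv dom′ =
    minimal _ (removed⊂D (M∈D v∈D)) (dom′ , rematching v∈D w∈D vw w≢Mv)

  adj⇒M : (∀ x → x ∈ D) → ∀ {u v} → Adj G u v → v ≡ M u
  adj⇒M full {u} {v} uv with v FP.≟ M u
  ... | yes v≡Mu = v≡Mu
  ... | no v≢Mu  = contradiction dom′ (rematched-not-dominating (full u) (full v) uv v≢Mu)
    where
    dom′ : Dominating G (D - M u - M v)
    dom′ z with z FP.≟ M u | z FP.≟ M v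
    ... | yes refl | _        =
      inj₂ (u , ∈-removed⁺ (full u) (M≢ (full u) ∘ sym) (v≢Mu ∘ M-swap (full v)) , adj-M (full u))
    ... | no _     | yes refl = inj₂ (v , ∈-removed⁺ (full v) v≢Mu (M≢ (full v) ∘ sym) , adj-M (full v))
    ... | no z≢Mu  | no z≢Mv  = inj₁ (∈-removed⁺ (full z) z≢Mu z≢Mv)

  module _ (adj? : ∀ u v → Dec (Adj G u v)) where

    open Domination G adj?

    pair-private : ∀ {v} → v ∈ D → ∃[ z ] ((z ∈ D → v ≋ z) × (∀ {s} → s ∈ D → Adj G s z → v ≋ s))
    pair-private {v} v∈D =
      let z , undominated = FP.¬∀⟶∃¬ n _ dominated? (pair-removed-not-dominating v∈D) in
      z , (λ z∈D → ∉-removed z∈D (undominated ∘ inj₁))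
        , (λ s∈D sz → ∉-removed s∈D λ s∈ → undominated (inj₂ (_ , s∈ , sz)))
      where
      dominated? : ∀ z → Dec (z ∈ D - v - M v ⊎ ∃[ u ] (u ∈ D - v - M v × Adj G u z))
      dominated? z = (z ∈? _) ⊎-dec FP.any? λ u → (u ∈? _) ×-dec adj? u z

    PrivateNeighbour : Fin n → Fin n → Set
    PrivateNeighbour f y = y ∉ D × Adj G y f × (∀ {z} → z ∈ D → Adj G y z → z ≡ f)

    HasPrivateNeighbour : Fin n → Set
    HasPrivateNeighbour f = ∃ (PrivateNeighbour f)

    OnlyPartner : Fin n → Set
    OnlyPartner u = ∀ {z} → z ∈ D → Adj G u z → z ≡ M u

    only-partner-adj⇒≋ : ∀ {v v′ r r′} → v ∈ D → v′ ∈ D →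
      v ≋ r → OnlyPartner r → v′ ≋ r′ → Adj G r r′ → v ≋ v′
    only-partner-adj⇒≋ v∈D v′∈D v≋r r-only v′≋r′ rr′ =
      ≋-chain v∈D v′∈D v≋r (inj₂ (r-only (≋-closed v′∈D v′≋r′) rr′)) v′≋r′

    pair-classification : ∀ {v} → v ∈ D → ∃[ u ] (v ≋ u × (OnlyPartner u ⊎ HasPrivateNeighbour u))
    pair-classification {v} v∈D with pair-private v∈D
    ... | z , inD⇒≋ , nbr⇒≋ with z ∈? D
    ...   | yes z∈D = z , inD⇒≋ z∈D , inj₁ only
      where
      only : OnlyPartner z
      only s∈D zs with ≋-trans z∈D (≋-sym v∈D (inD⇒≋ z∈D)) (nbr⇒≋ s∈D (sym-adj G zs))
      ... | inj₁ refl = contradiction zs (irrefl G)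
      ... | inj₂ s≡Mz = s≡Mz
    ...   | no z∉D with dom z
    ...     | inj₁ z∈D            = contradiction z∈D z∉D
    ...     | inj₂ (s , s∈D , sz) = s , nbr⇒≋ s∈D sz , inj₂ (z , z∉D , sym-adj G sz , unique)
      where
      unique : ∀ {t} → t ∈ D → Adj G z t → t ≡ s
      unique t∈D zt with ≋-trans s∈D (≋-sym v∈D (nbr⇒≋ s∈D sz)) (nbr⇒≋ t∈D (sym-adj G zt))
      ... | inj₁ t≡s  = t≡s
      ... | inj₂ refl = contradiction (sym-adj G zt) (triangle-free G girth (sym-adj G sz) (adj-M s∈D))

    Territory : Fin n → Fin n → Set
    Territory w r = ∃[ f ] (w ≋ f × (r ≡ f ⊎ PrivateNeighbour f r))

    ≋-territory : ∀ {w v r} → w ∈ D → w ≋ v → Territory v r → Territory w r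
    ≋-territory w∈D w≋v (f , v≋f , r-at-f) = f , ≋-trans w∈D w≋v v≋f , r-at-f

    territories-disjoint : ∀ {w w′ r} → w ∈ D → w′ ∈ D → Territory w r → Territory w′ r → w ≋ w′
    territories-disjoint w∈D w′∈D (f , w≋f , r-at-f) (f′ , w′≋f′ , r-at-f′) =
      ≋-chain w∈D w′∈D w≋f (inj₁ (same-owner r-at-f r-at-f′)) w′≋f′
      where
      f∈D : f ∈ D
      f∈D = ≋-closed w∈D w≋f
      f′∈D : f′ ∈ D
      f′∈D = ≋-closed w′∈D w′≋f′
      same-owner : ∀ {r} → r ≡ f ⊎ PrivateNeighbour f r → r ≡ f′ ⊎ PrivateNeighbour f′ r → f′ ≡ f
      same-owner (inj₁ refl)               (inj₁ refl)                = refl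
      same-owner (inj₁ refl)               (inj₂ (f∉D , _))           = contradiction f∈D f∉D
      same-owner (inj₂ (f′∉D , _))         (inj₁ refl)                = contradiction f′∈D f′∉D
      same-owner (inj₂ (_ , _ , unique))   (inj₂ (_ , rf′ , _))       = unique f′∈D rf′

    no-large-transversal : ∀ {S x₀} → MinimalDominating G S → x₀ ∈ S → (φ : Fin n → Fin n) →
      (∀ {w} → w ∈ D → φ w ∈ S × φ w ≢ x₀) →
      (∀ {w w′} → w ∈ D → w′ ∈ D → φ w ≡ φ w′ → w ≋ w′) → ⊥
    no-large-transversal {S} {x₀} minS x₀∈S φ into fibres = ℕP.<-irrefl refl (begin-strict
      γ + γ                    ≡⟨ cong (γ +_) (ℕP.+-identityʳ γ) ⟨
      2 * γ                    ≡⟨ ∣D∣≡2γ ⟨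
      ∣ D ∣                    ≤⟨ pair-bound (S - x₀) φ (uncurry x∈p∧x≢y⇒x∈p-y ∘ into) fibres ⟩
      ∣ S - x₀ ∣ + ∣ S - x₀ ∣  <⟨ ℕP.+-mono-< ∣S-x₀∣<γ ∣S-x₀∣<γ ⟩
      γ + γ                    ∎)
      where
      open ℕP.≤-Reasoning
      ∣S-x₀∣<γ : ∣ S - x₀ ∣ < γ
      ∣S-x₀∣<γ = ℕP.<-≤-trans (x∈p⇒∣p-x∣<∣p∣ x₀∈S) (Γ-bound S minS)

    record IndependentTransversal : Set₁ where
      field
        x₀                  : Fin n
        Chosen              : Fin n → Fin n → Set
        choose              : ∀ {v} → v ∈ D → ∃ (Chosen v)
        chosen-territory    : ∀ {v r} → v ∈ D → Chosen v r → Territory v r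
        chosen-x₀           : ∀ {v r} → v ∈ D → Chosen v r → r ≢ x₀ × ¬ Adj G x₀ r
        chosen-independent  : ∀ {v v′ r r′} → v ∈ D → v′ ∈ D → ¬ v ≋ v′ →
                              Chosen v r → Chosen v′ r′ → ¬ Adj G r r′

    module _ (T : IndependentTransversal) where
      open IndependentTransversal T

      private
        pick : Fin n → Fin n
        pick v with v ∈? D
        ... | yes v∈D = proj₁ (choose v∈D)
        ... | no _    = v

        pick-chosen : ∀ {v} → v ∈ D → Chosen v (pick v)
        pick-chosen {v} v∈D with v ∈? D
        ... | yes v∈D′ = proj₂ (choose v∈D′)
        ... | no v∉D   = contradiction v∈D v∉D

        -- Choosing through the representative makes ρ constant on pairs.
        ρ : Fin n → Fin n
        ρ w = pick (rep w)

        ρ-chosen : ∀ {w} → w ∈ D → Chosen (rep w) (ρ w)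
        ρ-chosen w∈D = pick-chosen (rep∈D w∈D)

        ρ-territory : ∀ {w} → w ∈ D → Territory w (ρ w)
        ρ-territory {w} w∈D = ≋-territory w∈D (≋-rep w) (chosen-territory (rep∈D w∈D) (ρ-chosen w∈D))

        InI : Fin n → Set
        InI a = a ≡ x₀ ⊎ ∃[ w ] (w ∈ D × ρ w ≡ a)

        InI? : Decidable InI
        InI? a = (a FP.≟ x₀) ⊎-dec FP.any? λ w → (w ∈? D) ×-dec (ρ w FP.≟ a)

        I : Subset n
        I = select InI?

        I-independent : Independent I
        I-independent a∈I b∈I = independent (∈-select⁻ InI? a∈I) (∈-select⁻ InI? b∈I)
          where
          independent : ∀ {a b} → InI a → InI b → ¬ Adj G a b
          independent (inj₁ refl)             (inj₁ refl)             = irrefl G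
          independent (inj₁ refl)             (inj₂ (w , w∈D , refl)) =
            proj₂ (chosen-x₀ (rep∈D w∈D) (ρ-chosen w∈D))
          independent (inj₂ (w , w∈D , refl)) (inj₁ refl)             =
            proj₂ (chosen-x₀ (rep∈D w∈D) (ρ-chosen w∈D)) ∘ sym-adj G
          independent (inj₂ (w , w∈D , refl)) (inj₂ (w′ , w′∈D , refl)) with rep w FP.≟ rep w′
          ... | yes e   = λ a → irrefl G (subst (Adj G (ρ w)) (cong pick (sym e)) a)
          ... | no rep≢ =
            chosen-independent (rep∈D w∈D) (rep∈D w′∈D) not-paired (ρ-chosen w∈D) (ρ-chosen w′∈D)
            where
            not-paired : ¬ rep w ≋ rep w′
            not-paired p = rep≢ (sym (trans (sym (rep-idempotent w′∈D))
                                 (trans (rep-cong (rep∈D w∈D) p) (rep-idempotent w∈D))))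

      no-independent-transversal : ⊥
      no-independent-transversal with independent⊆minimal-dominating I-independent
      ... | S , I⊆S , minS = no-large-transversal minS (I⊆S (∈-select⁺ InI? (inj₁ refl))) ρ into fibres
        where
        into : ∀ {w} → w ∈ D → ρ w ∈ S × ρ w ≢ x₀
        into w∈D = I⊆S (∈-select⁺ InI? (inj₂ (_ , w∈D , refl))) , proj₁ (chosen-x₀ (rep∈D w∈D) (ρ-chosen w∈D))
        fibres : ∀ {w w′} → w ∈ D → w′ ∈ D → ρ w ≡ ρ w′ → w ≋ w′
        fibres {w′ = w′} w∈D w′∈D e =
          territories-disjoint w∈D w′∈D (ρ-territory w∈D) (subst (Territory w′) (sym e) (ρ-territory w′∈D))

    _≋?_ : ∀ x y → Dec (x ≋ y)
    x ≋? y = (y FP.≟ x) ⊎-dec (y FP.≟ M x)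

    -- A minimal dominating S ⊆ D meets every pair and here contains both v and M v.
    no-doubly-private-pair : ∀ {v} → v ∈ D → HasPrivateNeighbour v → ¬ HasPrivateNeighbour (M v)
    no-doubly-private-pair {v} v∈D v-private Mv-private with minimal-dominating-⊆ dom
    ... | S , S⊆D , minS@(domS , _) = no-large-transversal minS (forced Mv-private) φ (proj₂ ∘ φ-spec) fibres
      where
      forced : ∀ {u} → HasPrivateNeighbour u → u ∈ S
      forced (y , y∉D , yu , unique) with domS y
      ... | inj₁ y∈S            = contradiction (S⊆D y∈S) y∉D
      ... | inj₂ (s , s∈S , sy) = subst (_∈ S) (unique (S⊆D s∈S) (sym-adj G sy)) s∈S
      meets : ∀ {w} → w ∈ D → ∃[ u ] (w ≋ u × u ∈ S)
      meets w∈D with pair-private w∈D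
      ... | z , inD⇒≋ , nbr⇒≋ with domS z
      ...   | inj₁ z∈S            = z , inD⇒≋ (S⊆D z∈S) , z∈S
      ...   | inj₂ (s , s∈S , sz) = s , nbr⇒≋ (S⊆D s∈S) sz , s∈S
      φ : Fin n → Fin n
      φ w with v ≋? w | w ∈? S
      ... | yes _ | _     = v
      ... | no _  | yes _ = w
      ... | no _  | no _  = M w
      φ-spec : ∀ {w} → w ∈ D → w ≋ φ w × φ w ∈ S × φ w ≢ M v
      φ-spec {w} w∈D with v ≋? w | w ∈? S
      ... | yes v≋w | _       = ≋-sym v∈D v≋w , forced v-private , M≢ v∈D ∘ sym
      ... | no v≉w  | yes w∈S = ≋-refl , w∈S , v≉w ∘ inj₂
      ... | no v≉w  | no w∉S  with meets w∈D
      ...   | _ , inj₁ refl , w∈S  = contradiction w∈S w∉S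
      ...   | _ , inj₂ refl , Mw∈S = ≋-partner , Mw∈S , v≉w ∘ inj₁ ∘ M-injective w∈D v∈D
      fibres : ∀ {w w′} → w ∈ D → w′ ∈ D → φ w ≡ φ w′ → w ≋ w′
      fibres w∈D w′∈D e = ≋-chain w∈D w′∈D (proj₁ (φ-spec w∈D)) (inj₁ (sym e)) (proj₁ (φ-spec w′∈D))

    private-neighbours-nonadjacent : ∀ {v w} → v ∈ D → w ∈ D →
      HasPrivateNeighbour v → HasPrivateNeighbour w → ¬ Adj G v w
    private-neighbours-nonadjacent {v} {w} v∈D w∈D v-private w-private vw with w FP.≟ M v
    ... | yes refl = no-doubly-private-pair v∈D v-private w-private
    ... | no w≢Mv  = rematched-not-dominating v∈D w∈D vw w≢Mv dom′
      where
      D′ : Subset n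
      D′ = D - M v - M w
      v∈D′ : v ∈ D′
      v∈D′ = ∈-removed⁺ v∈D (M≢ v∈D ∘ sym) (w≢Mv ∘ M-swap w∈D)
      w∈D′ : w ∈ D′
      w∈D′ = ∈-removed⁺ w∈D w≢Mv (M≢ w∈D ∘ sym)
      -- A vertex seen by D only through M v and M w is a private neighbour of one of them
      -- or closes a 5-cycle through v and w.
      only-through-removed : ∀ {z} → z ∉ D → (∀ {t} → t ∈ D → Adj G z t → t ≡ M v ⊎ t ≡ M w) → ⊥
      only-through-removed {z} z∉D through with adj? z (M v) | adj? z (M w)
      ... | yes zMv | yes zMw =
        pentagon-free G girth zMv (sym-adj G (adj-M v∈D)) vw (adj-M w∈D) (sym-adj G zMw)
      ... | yes zMv | no ¬zMw = no-doubly-private-pair v∈D v-private (z , z∉D , zMv , λ t∈D zt →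
          [ id , (λ { refl → contradiction zt ¬zMw }) ] (through t∈D zt))
      ... | no ¬zMv | yes zMw = no-doubly-private-pair w∈D w-private (z , z∉D , zMw , λ t∈D zt →
          [ (λ { refl → contradiction zt ¬zMv }) , id ] (through t∈D zt))
      ... | no ¬zMv | no ¬zMw with dom z
      ...   | inj₁ z∈D            = z∉D z∈D
      ...   | inj₂ (s , s∈D , sz) with through s∈D (sym-adj G sz)
      ...     | inj₁ refl = ¬zMv (sym-adj G sz)
      ...     | inj₂ refl = ¬zMw (sym-adj G sz)
      dom′ : Dominating G D′
      dom′ z with z ∈? D′ | z FP.≟ M v | z FP.≟ M w
      ... | yes z∈D′ | _        | _        = inj₁ z∈D′
      ... | no _     | yes refl | _        = inj₂ (v , v∈D′ , adj-M v∈D)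
      ... | no _     | no _     | yes refl = inj₂ (w , w∈D′ , adj-M w∈D)
      ... | no z∉D′  | no z≢Mv  | no z≢Mw  with FP.any? (λ t → (t ∈? D′) ×-dec adj? t z)
      ...   | yes (t , t∈D′ , tz) = inj₂ (t , t∈D′ , tz)
      ...   | no none = ⊥-elim (only-through-removed (z∉D′ ∘ λ z∈D → ∈-removed⁺ z∈D z≢Mv z≢Mw)
                          λ t∈D zt → ∉-removed t∈D λ t∈D′ → none (_ , t∈D′ , sym-adj G zt))

    module _ (no-private : ∀ {v} → v ∈ D → ¬ HasPrivateNeighbour v) {x} (x∉D : x ∉ D) where

      private data Chosen (v : Fin n) : Fin n → Set where
        far  : ∀ {u} → v ≋ u → OnlyPartner u → ¬ Adj G x u → Chosen v u
        near : ∀ {u} → v ≋ u → OnlyPartner u → Adj G x u → Chosen v (M u)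

      private
        chosen-≋ : ∀ {v r} → v ∈ D → Chosen v r → v ≋ r
      chosen-≋ v∈D (far v≋u _ _)  = v≋u
      chosen-≋ v∈D (near v≋u _ _) = ≋-trans v∈D v≋u ≋-partner

      outside-vertex-transversal : IndependentTransversal
      outside-vertex-transversal = record
        { x₀ = x ; Chosen = Chosen ; choose = choose ; chosen-territory = territory
        ; chosen-x₀ = avoids-x ; chosen-independent = independent }
        where
        choose : ∀ {v} → v ∈ D → ∃ (Chosen v)
        choose v∈D with pair-classification v∈D
        ... | u , v≋u , inj₂ u-private = ⊥-elim (no-private (≋-closed v∈D v≋u) u-private)
        ... | u , v≋u , inj₁ u-only with adj? x u
        ...   | yes xu = M u , near v≋u u-only xu
        ...   | no ¬xu = u , far v≋u u-only ¬xu
        territory : ∀ {v r} → v ∈ D → Chosen v r → Territory v r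
        territory v∈D c = _ , chosen-≋ v∈D c , inj₁ refl
        avoids-x : ∀ {v r} → v ∈ D → Chosen v r → r ≢ x × ¬ Adj G x r
        avoids-x v∈D c = (λ { refl → x∉D (≋-closed v∈D (chosen-≋ v∈D c)) }) , ¬adj c
          where
          ¬adj : ∀ {r} → Chosen _ r → ¬ Adj G x r
          ¬adj (far _ _ ¬xu)   = ¬xu
          ¬adj (near v≋u _ xu) = triangle-free G girth xu (adj-M (≋-closed v∈D v≋u)) ∘ sym-adj G
        independent : ∀ {v v′ r r′} → v ∈ D → v′ ∈ D → ¬ v ≋ v′ → Chosen v r → Chosen v′ r′ → ¬ Adj G r r′
        independent v∈D v′∈D v≉v′ (near v≋u _ xu) (near v′≋u′ _ xu′) MuMu′ =
          pentagon-free G girth xu (adj-M (≋-closed v∈D v≋u)) MuMu′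
            (sym-adj G (adj-M (≋-closed v′∈D v′≋u′))) (sym-adj G xu′)
        independent v∈D v′∈D v≉v′ c@(far _ r-only _) c′ rr′ =
          v≉v′ (only-partner-adj⇒≋ v∈D v′∈D (chosen-≋ v∈D c) r-only (chosen-≋ v′∈D c′) rr′)
        independent v∈D v′∈D v≉v′ c@(near _ _ _) c′@(far _ r′-only _) rr′ =
          v≉v′ (≋-sym v′∈D
            (only-partner-adj⇒≋ v′∈D v∈D (chosen-≋ v′∈D c′) r′-only (chosen-≋ v∈D c) (sym-adj G rr′)))

    module _ {f₀ p₀} (f₀∈D : f₀ ∈ D) (p₀-private : PrivateNeighbour f₀ p₀) where

      private
        p₀∉D : p₀ ∉ D
        p₀∉D = proj₁ p₀-private
        p₀f₀ : Adj G p₀ f₀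
        p₀f₀ = proj₁ (proj₂ p₀-private)
        p₀-unique : ∀ {z} → z ∈ D → Adj G p₀ z → z ≡ f₀
        p₀-unique = proj₂ (proj₂ p₀-private)

      private data Chosen (v : Fin n) : Fin n → Set where
        own    : f₀ ≋ v → Chosen v (M f₀)
        beyond : ∀ {f r} → ¬ f₀ ≋ v → v ≋ f → PrivateNeighbour f r → Adj G f (M f₀) → Chosen v r
        holder : ∀ {r} → ¬ f₀ ≋ v → v ≋ r → HasPrivateNeighbour r → ¬ Adj G r (M f₀) → Chosen v r
        lonely : ∀ {r} → ¬ f₀ ≋ v → v ≋ r → OnlyPartner r → Chosen v r

      private-neighbour-transversal : IndependentTransversal
      private-neighbour-transversal = record
        { x₀ = p₀ ; Chosen = Chosen ; choose = choose ; chosen-territory = territory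
        ; chosen-x₀ = avoids-p₀ ; chosen-independent = independent }
        where
        choose : ∀ {v} → v ∈ D → ∃ (Chosen v)
        choose {v} v∈D with f₀ ≋? v
        ... | yes f₀≋v = M f₀ , own f₀≋v
        ... | no f₀≉v with pair-classification v∈D
        ...   | u , v≋u , inj₁ u-only = u , lonely f₀≉v v≋u u-only
        ...   | u , v≋u , inj₂ (y , y-private) with adj? u (M f₀)
        ...     | yes uMf₀ = y , beyond f₀≉v v≋u y-private uMf₀
        ...     | no ¬uMf₀ = u , holder f₀≉v v≋u (y , y-private) ¬uMf₀
        territory : ∀ {v r} → v ∈ D → Chosen v r → Territory v r
        territory v∈D (own f₀≋v)                  = M f₀ , ≋-trans v∈D (≋-sym f₀∈D f₀≋v) ≋-partner , inj₁ refl
        territory v∈D (beyond _ v≋f r-private _)  = _ , v≋f , inj₂ r-private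
        territory v∈D (holder _ v≋r _ _)          = _ , v≋r , inj₁ refl
        territory v∈D (lonely _ v≋r _)            = _ , v≋r , inj₁ refl
        in-D-avoids-p₀ : ∀ {v r} → v ∈ D → ¬ f₀ ≋ v → v ≋ r → r ≢ p₀ × ¬ Adj G p₀ r
        in-D-avoids-p₀ v∈D f₀≉v v≋r = (λ { refl → p₀∉D (≋-closed v∈D v≋r) })
          , λ p₀r → f₀≉v (≋-chain f₀∈D v∈D ≋-refl (inj₁ (p₀-unique (≋-closed v∈D v≋r) p₀r)) v≋r)
        avoids-p₀ : ∀ {v r} → v ∈ D → Chosen v r → r ≢ p₀ × ¬ Adj G p₀ r
        avoids-p₀ v∈D (own _) = (λ e → p₀∉D (subst (_∈ D) e (M∈D f₀∈D)))
          , λ p₀Mf₀ → M≢ f₀∈D (p₀-unique (M∈D f₀∈D) p₀Mf₀)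
        avoids-p₀ v∈D (beyond f₀≉v v≋f (_ , rf , _) fMf₀) =
          (λ { refl → f₀≉v (≋-chain f₀∈D v∈D ≋-refl (inj₁ (p₀-unique (≋-closed v∈D v≋f) rf)) v≋f) })
          , λ p₀r → pentagon-free G girth p₀f₀ (adj-M f₀∈D) (sym-adj G fMf₀) (sym-adj G rf) (sym-adj G p₀r)
        avoids-p₀ v∈D (holder f₀≉v v≋r _ _) = in-D-avoids-p₀ v∈D f₀≉v v≋r
        avoids-p₀ v∈D (lonely f₀≉v v≋r _)   = in-D-avoids-p₀ v∈D f₀≉v v≋r
        avoids-Mf₀ : ∀ {v r} → v ∈ D → ¬ f₀ ≋ v → Chosen v r → ¬ Adj G r (M f₀)
        avoids-Mf₀ v∈D f₀≉v (own f₀≋v) = contradiction f₀≋v f₀≉v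
        avoids-Mf₀ v∈D f₀≉v (beyond _ v≋f (_ , _ , r-unique) _) rMf₀ =
          f₀≉v (≋-chain f₀∈D v∈D ≋-partner (inj₁ (sym (r-unique (M∈D f₀∈D) rMf₀))) v≋f)
        avoids-Mf₀ v∈D f₀≉v (holder _ _ _ ¬rMf₀) = ¬rMf₀
        avoids-Mf₀ v∈D f₀≉v (lonely _ v≋r r-only) rMf₀ =
          f₀≉v (≋-chain f₀∈D v∈D ≋-refl
            (inj₁ (M-injective (≋-closed v∈D v≋r) f₀∈D (sym (r-only (M∈D f₀∈D) rMf₀)))) v≋r)
        both-own : ∀ {v v′} → v ∈ D → v′ ∈ D → f₀ ≋ v → f₀ ≋ v′ → v ≋ v′
        both-own v∈D v′∈D f₀≋v f₀≋v′ = ≋-chain v∈D v′∈D (≋-sym f₀∈D f₀≋v) ≋-refl (≋-sym f₀∈D f₀≋v′)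
        independent : ∀ {v v′ r r′} → v ∈ D → v′ ∈ D → ¬ v ≋ v′ → Chosen v r → Chosen v′ r′ → ¬ Adj G r r′
        independent v∈D v′∈D v≉v′ (own f₀≋v) (own f₀≋v′) _ = v≉v′ (both-own v∈D v′∈D f₀≋v f₀≋v′)
        independent v∈D v′∈D v≉v′ (own f₀≋v) c′ rr′ =
          avoids-Mf₀ v′∈D (v≉v′ ∘ both-own v∈D v′∈D f₀≋v) c′ (sym-adj G rr′)
        independent v∈D v′∈D v≉v′ c (own f₀≋v′) rr′ =
          avoids-Mf₀ v∈D (λ f₀≋v → v≉v′ (both-own v∈D v′∈D f₀≋v f₀≋v′)) c rr′
        independent v∈D v′∈D v≉v′ (beyond _ _ (_ , rf , _) fMf₀) (beyond _ _ (_ , r′f′ , _) f′Mf₀) rr′ =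
          pentagon-free G girth rf fMf₀ (sym-adj G f′Mf₀) (sym-adj G r′f′) (sym-adj G rr′)
        independent v∈D v′∈D v≉v′ (beyond _ v≋f (_ , _ , r-unique) _) (holder _ v′≋r′ _ _) rr′ =
          v≉v′ (≋-chain v∈D v′∈D v≋f (inj₁ (r-unique (≋-closed v′∈D v′≋r′) rr′)) v′≋r′)
        independent v∈D v′∈D v≉v′ (beyond _ v≋f (_ , _ , r-unique) _) (lonely _ v′≋r′ _) rr′ =
          v≉v′ (≋-chain v∈D v′∈D v≋f (inj₁ (r-unique (≋-closed v′∈D v′≋r′) rr′)) v′≋r′)
        independent v∈D v′∈D v≉v′ (holder _ v≋r _ _) (beyond _ v′≋f′ (_ , _ , r′-unique) _) rr′ =
          v≉v′ (≋-chain v∈D v′∈D v≋r (inj₁ (sym (r′-unique (≋-closed v∈D v≋r) (sym-adj G rr′)))) v′≋f′)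
        independent v∈D v′∈D v≉v′ (lonely _ v≋r _) (beyond _ v′≋f′ (_ , _ , r′-unique) _) rr′ =
          v≉v′ (≋-chain v∈D v′∈D v≋r (inj₁ (sym (r′-unique (≋-closed v∈D v≋r) (sym-adj G rr′)))) v′≋f′)
        independent v∈D v′∈D v≉v′ (holder _ v≋r r-private _) (holder _ v′≋r′ r′-private _) =
          private-neighbours-nonadjacent (≋-closed v∈D v≋r) (≋-closed v′∈D v′≋r′) r-private r′-private
        independent v∈D v′∈D v≉v′ (lonely _ v≋r r-only) (holder _ v′≋r′ _ _) rr′ =
          v≉v′ (only-partner-adj⇒≋ v∈D v′∈D v≋r r-only v′≋r′ rr′)
        independent v∈D v′∈D v≉v′ (lonely _ v≋r r-only) (lonely _ v′≋r′ _) rr′ =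
          v≉v′ (only-partner-adj⇒≋ v∈D v′∈D v≋r r-only v′≋r′ rr′)
        independent v∈D v′∈D v≉v′ (holder _ v≋r _ _) (lonely _ v′≋r′ r′-only) rr′ =
          v≉v′ (≋-sym v′∈D (only-partner-adj⇒≋ v′∈D v∈D v′≋r′ r′-only v≋r (sym-adj G rr′)))

    private-neighbour? : ∀ f y → Dec (PrivateNeighbour f y)
    private-neighbour? f y = ¬? (y ∈? D) ×-dec adj? y f ×-dec
      map′ (λ all {z} → all z) (λ all z → all {z}) (FP.all? λ z → (z ∈? D) →-dec (adj? y z →-dec (z FP.≟ f)))

    nothing-outside-D : ∀ {x} → x ∉ D → ⊥
    nothing-outside-D x∉D with FP.any? (λ v → (v ∈? D) ×-dec FP.any? (private-neighbour? v))
    ... | yes (_ , f₀∈D , _ , p₀-private) =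
      no-independent-transversal (private-neighbour-transversal f₀∈D p₀-private)
    ... | no none = no-independent-transversal
                      (outside-vertex-transversal (λ v∈D v-private → none (_ , v∈D , v-private)) x∉D)

  -- Adjacency need not be decidable, but x ∈ D is, so we may argue under ¬ ¬ decidability.
  D-full : ∀ x → x ∈ D
  D-full x with x ∈? D
  ... | yes x∈D = x∈D
  ... | no x∉D  = ⊥-elim (¬¬-adj? G λ adj? → nothing-outside-D adj? x∉D)

  1-regular : 1-Regular G
  1-regular = record { partner = M ; adj-partner = λ u → adj-M (D-full u) ; adj⇒partner = adj⇒M D-full }

theorem12 : ∀ {n} → n ≥ 1 → (G : Graph n) → GirthAtLeast6 G →
    ∀ (γ γpr : ℕ) → IsUpperDomination G γ → IsUpperPairedDomination G γpr →
      (γpr ≡ 2 * γ) ⇔ (∃[ m ] (m ≥ 1 × G ≅ mK₂ m))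
theorem12 {n} n≥1 G girth γ γpr ((Dγ , minDγ , ∣Dγ∣≡γ) , Γ-bound) ((D , (pds , minD) , ∣D∣≡γpr) , _) =
  mk⇔ to from
  where
  to : γpr ≡ 2 * γ → ∃[ m ] (m ≥ 1 × G ≅ mK₂ m)
  to γpr≡2γ = m , m≥1 , ≅mK₂
    where
    open 1-RegularGraph (ExtremalPDS.1-regular G girth pds minD Γ-bound (trans ∣D∣≡γpr γpr≡2γ))
    m≥1 : m ≥ 1
    m≥1 with m | n≡2m
    ... | suc _ | _  = s≤s z≤n
    ... | zero  | n≡0 rewrite n≡0 = n≥1
  from : ∃[ m ] (m ≥ 1 × G ≅ mK₂ m) → γpr ≡ 2 * γ
  from (m , _ , G≅mK₂) = begin
    γpr           ≡⟨ ∣D∣≡γpr ⟨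
    ∣ D ∣         ≡⟨ full⇒∣p∣≡n (paired-dominating⇒full pds) ⟩
    n             ≡⟨ minimal-dominating⇒half minDγ ⟨
    ∣ Dγ ∣ + ∣ Dγ ∣ ≡⟨ cong₂ _+_ ∣Dγ∣≡γ (trans ∣Dγ∣≡γ (sym (ℕP.+-identityʳ γ))) ⟩
    2 * γ         ∎
    where
    open ≡-Reasoning
    open 1-RegularGraph (1-regular-≅ {G = G} G≅mK₂ (mK₂-1-regular m))
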